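{- Let $G$ be a group and let $G'$ be a group containing $G$ as a normal subgroup of index $2$. Then $G'$ is a GI-extension of $G$ if and only if there is an automorphism $\sigma\in\operatorname{Aut}(G)$ with $\sigma^2=\mathrm{id}$ such that $G$ is generated by the set $\{g\in G: \sigma(g)=g^{ -1}\}$ and $G'\cong G\rtimes_\sigma C_2$ (where the generator of $C_2$ acts on $G$ by $\sigma$), via an isomorphism carrying $G$ onto the normal factor $G$.
   Context: Definition: given a group $G'$ and a normal subgroup $G\trianglelefteq G'$ of index $2$, $G'$ is called a GI-extension of $G$ if $G'$ is generated by involutions (elements of order $2$) that are not contained in $G$. An automorphism $\sigma$ of $G$ such that $G$ is generated by $\{g\in G:\sigma(g)=g^{ -1}\}$ is called a GI-automorphism. -}

module Defs where

open import Level using (Level; _⊔_)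
open import Data.Bool using (Bool; true; false; _xor_)
open import Data.Product using (Σ; _×_; _,_; ∃)
open import Data.Sum using (_⊎_)
open import Relation.Nullary using (¬_)
open import Relation.Binary.PropositionalEquality using (_≡_)
open import Algebra.Bundles using (Group)
open import Algebra.Bundles.Raw using (RawGroup)
open import Algebra.Morphism.Structures using (module GroupMorphisms)

private variable c ℓ c' ℓ' : Level

module _ (G : Group c ℓ) where
  open Group G

  data Gen {p : Level} (S : Carrier → Set p) : Carrier → Set (c ⊔ ℓ ⊔ p) where
    gen-base : ∀ {x} → S x → Gen S x
    gen-ε    : Gen S ε
    gen-inv  : ∀ {x} → Gen S x → Gen S (x ⁻¹)
    gen-mul  : ∀ {x y} → Gen S x → Gen S y → Gen S (x ∙ y)
    gen-resp : ∀ {x y} → x ≈ y → Gen S x → Gen S y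

  GeneratedBy : {p : Level} → (Carrier → Set p) → Set (c ⊔ ℓ ⊔ p)
  GeneratedBy S = ∀ x → Gen S x

  Involution : Carrier → Set ℓ
  Involution x = (x ∙ x ≈ ε) × ¬ (x ≈ ε)

-- A group G' containing G as a subgroup: an injective homomorphism ι : G → G'.
module _ (G : Group c ℓ) (G' : Group c' ℓ') where
  private
    module G  = Group G
    module G' = Group G'
  open GroupMorphisms G.rawGroup G'.rawGroup

  InImage : (G.Carrier → G'.Carrier) → G'.Carrier → Set (c ⊔ ℓ')
  InImage ι x = ∃ λ g → ι g G'.≈ x

  IsNormalImage : (G.Carrier → G'.Carrier) → Set (c ⊔ c' ⊔ ℓ')
  IsNormalImage ι = ∀ x y → InImage ι y → InImage ι ((x G'.∙ y) G'.∙ (x G'.⁻¹))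

  IsIndex2Image : (G.Carrier → G'.Carrier) → Set (c ⊔ c' ⊔ ℓ')
  IsIndex2Image ι = Σ G'.Carrier λ t → ¬ InImage ι t ×
                      (∀ x → InImage ι x ⊎ InImage ι ((t G'.⁻¹) G'.∙ x))

  IsGIExtension : (G.Carrier → G'.Carrier) → Set (c ⊔ c' ⊔ ℓ')
  IsGIExtension ι = GeneratedBy G' (λ x → Involution G' x × ¬ InImage ι x)

-- Semidirect product G ⋊_σ C₂, with C₂ = (Bool, xor) and the generator true acting by σ.
-- Only the raw operations are given; they form a group whenever σ is an
-- involutive automorphism.
module _ (G : Group c ℓ) where
  open Group G

  act : (Carrier → Carrier) → Bool → Carrier → Carrier
  act σ false g = g
  act σ true  g = σ g

  SemidirectC2 : (Carrier → Carrier) → RawGroup c ℓ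
  SemidirectC2 σ = record
    { Carrier = Carrier × Bool
    ; _≈_ = λ { (g , a) (h , b) → (g ≈ h) × (a ≡ b) }
    ; _∙_ = λ { (g , a) (h , b) → (g ∙ act σ a h , a xor b) }
    ; ε = (ε , false)
    ; _⁻¹ = λ { (g , a) → (act σ a (g ⁻¹) , a) }
    }

{-# OPTIONS --safe #-}
-- If G' is generated by involutions outside G, such an involution s exists, and as G has
-- index 2, G' = G ⊔ G s. Conjugation by s restricts to an involutive automorphism σ of G, and
-- (g , b) ↦ g sᵇ identifies G ⋊_σ C₂ with G'. In G ⋊_σ C₂ the involutions outside G are
-- exactly the (a , true) with σ a = a⁻¹. The subgroup generated by these a is σ-stable, so
-- its product with C₂ is a subgroup containing all generators of G', hence everything; this
-- forces it to be all of G. Conversely (a , false) = (a , true) (1 , true), so the involutions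
-- (a , true) generate G ⋊_σ C₂ as soon as the a with σ a = a⁻¹ generate G.
module Submission where

open import Defs
open import Level using (Level)
open import Data.Bool using (Bool; false; true; not; _xor_)
open import Data.Product using (Σ; _×_; _,_; ∃; proj₁; proj₂)
open import Data.Sum using (_⊎_; inj₁; inj₂)
open import Data.Empty using (⊥-elim)
open import Function using (_∘_)
open import Function.Bundles using (_⇔_; mk⇔)
open import Relation.Nullary using (¬_)
open import Relation.Binary.PropositionalEquality using () renaming (refl to ≡-refl)
open import Algebra.Bundles using (Group)
open import Algebra.Bundles.Raw using (module RawGroup)
open import Algebra.Morphism.Structures using (module GroupMorphisms)
import Algebra.Properties.Group as GroupProperties
import Algebra.Properties.Monoid as MonoidProperties
import Relation.Binary.Reasoning.Setoid as ≈-Reasoning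

private variable c ℓ c' ℓ' p q : Level

module _ (G : Group c ℓ) (H : Group c' ℓ') where
  private
    module G = Group G
  open Group H
  open GroupProperties H using (identityˡ-unique; inverseʳ-unique)
  open GroupMorphisms G.rawGroup rawGroup

  ∙-homo⇒isGroupHomomorphism : ∀ {f} → (∀ {x y} → x G.≈ y → f x ≈ f y) →
                               (∀ x y → f (x G.∙ y) ≈ f x ∙ f y) →
                               IsGroupHomomorphism f
  ∙-homo⇒isGroupHomomorphism {f} f-cong f-homo = record
    { isMonoidHomomorphism = record
      { isMagmaHomomorphism = record
        { isRelHomomorphism = record { cong = f-cong }
        ; homo = f-homo
        }
      ; ε-homo = f-ε
      }
    ; ⁻¹-homo = f-⁻¹
    }
    where
    f-ε : f G.ε ≈ ε
    f-ε = identityˡ-unique (f G.ε) (f G.ε)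
            (trans (sym (f-homo G.ε G.ε)) (f-cong (G.identityˡ G.ε)))

    f-⁻¹ : ∀ x → f (x G.⁻¹) ≈ f x ⁻¹
    f-⁻¹ x = inverseʳ-unique (f x) (f (x G.⁻¹))
               (trans (sym (f-homo x (x G.⁻¹))) (trans (f-cong (G.inverseʳ x)) f-ε))

module _ (G : Group c ℓ) (H : Group c' ℓ') where
  private
    module G = Group G
  open Group H
  open GroupMorphisms G.rawGroup rawGroup

  module _ {f} (f-homo : IsGroupHomomorphism f) where
    private
      module F = IsGroupHomomorphism f-homo

    Gen-image : {S : G.Carrier → Set p} {T : Carrier → Set q} →
                (∀ {x} → S x → Gen H T (f x)) → ∀ {x} → Gen G S x → Gen H T (f x)
    Gen-image S⇒T (gen-base x∈S)  = S⇒T x∈S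
    Gen-image S⇒T gen-ε           = gen-resp (sym F.ε-homo) gen-ε
    Gen-image S⇒T (gen-inv {x} g) = gen-resp (sym (F.⁻¹-homo x)) (gen-inv (Gen-image S⇒T g))
    Gen-image S⇒T (gen-mul {x} {y} g h) =
      gen-resp (sym (F.homo x y)) (gen-mul (Gen-image S⇒T g) (Gen-image S⇒T h))
    Gen-image S⇒T (gen-resp x≈y g) = gen-resp (F.⟦⟧-cong x≈y) (Gen-image S⇒T g)

    index2-coset : IsIndex2Image G H f → ∀ {s} → ¬ InImage G H f s →
                   ∀ y → InImage G H f y ⊎ InImage G H f (s ⁻¹ ∙ y)
    index2-coset (t , _ , cover) {s} s∉ y with cover s | cover y
    ... | inj₁ s∈ | _      = ⊥-elim (s∉ s∈)
    ... | inj₂ _  | inj₁ y∈ = inj₁ y∈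
    ... | inj₂ (b , fb≈t⁻¹s) | inj₂ (d , fd≈t⁻¹y) = inj₂ (b G.⁻¹ G.∙ d , (begin
      f (b G.⁻¹ G.∙ d)                ≈⟨ F.homo (b G.⁻¹) d ⟩
      f (b G.⁻¹) ∙ f d                ≈⟨ ∙-cong (trans (F.⁻¹-homo b) (⁻¹-cong fb≈t⁻¹s)) fd≈t⁻¹y ⟩
      (t ⁻¹ ∙ s) ⁻¹ ∙ (t ⁻¹ ∙ y)      ≈⟨ ∙-congʳ (⁻¹-anti-homo-∙ (t ⁻¹) s) ⟩
      (s ⁻¹ ∙ t ⁻¹ ⁻¹) ∙ (t ⁻¹ ∙ y)   ≈⟨ cancelᶜ (inverseˡ (t ⁻¹)) (s ⁻¹) y ⟩
      s ⁻¹ ∙ y                        ∎))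
      where
      open ≈-Reasoning setoid
      open GroupProperties H using (⁻¹-anti-homo-∙)
      open MonoidProperties monoid using (cancelᶜ)

  module _ {ι} (ι-mono : IsGroupMonomorphism ι) where
    private
      module ι = IsGroupMonomorphism ι-mono

    restriction-isGroupHomomorphism :
      ∀ {f σ} → GroupMorphisms.IsGroupHomomorphism rawGroup rawGroup f →
      (∀ g → ι (σ g) ≈ f (ι g)) →
      GroupMorphisms.IsGroupHomomorphism G.rawGroup G.rawGroup σ
    restriction-isGroupHomomorphism {f} {σ} f-homo ισ≈fι =
      ∙-homo⇒isGroupHomomorphism G G σ-cong σ-homo
      where
      module F = GroupMorphisms.IsGroupHomomorphism f-homo
      open ≈-Reasoning setoid

      σ-cong : ∀ {x y} → x G.≈ y → σ x G.≈ σ y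
      σ-cong {x} {y} x≈y = ι.injective (begin
        ι (σ x)  ≈⟨ ισ≈fι x ⟩
        f (ι x)  ≈⟨ F.⟦⟧-cong (ι.⟦⟧-cong x≈y) ⟩
        f (ι y)  ≈⟨ ισ≈fι y ⟨
        ι (σ y)  ∎)

      σ-homo : ∀ x y → σ (x G.∙ y) G.≈ σ x G.∙ σ y
      σ-homo x y = ι.injective (begin
        ι (σ (x G.∙ y))    ≈⟨ ισ≈fι (x G.∙ y) ⟩
        f (ι (x G.∙ y))    ≈⟨ F.⟦⟧-cong (ι.∙-homo x y) ⟩
        f (ι x ∙ ι y)      ≈⟨ F.homo (ι x) (ι y) ⟩
        f (ι x) ∙ f (ι y)  ≈⟨ ∙-cong (ισ≈fι x) (ισ≈fι y) ⟨
        ι (σ x) ∙ ι (σ y)  ≈⟨ ι.∙-homo (σ x) (σ y) ⟨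
        ι (σ x G.∙ σ y)    ∎)

module _ (G : Group c ℓ) where
  open Group G
  open GroupProperties G using (ε⁻¹≈ε; ⁻¹-anti-homo-∙)
  open MonoidProperties monoid using (cancelᶜ)
  open GroupMorphisms rawGroup rawGroup
  open ≈-Reasoning setoid

  involutive-isGroupIsomorphism : ∀ {σ} → IsGroupHomomorphism σ → (∀ g → σ (σ g) ≈ g) →
                                  IsGroupIsomorphism σ
  involutive-isGroupIsomorphism {σ} σ-homo σσ≈id = record
    { isGroupMonomorphism = record
      { isGroupHomomorphism = σ-homo
      ; injective = λ {x} {y} σx≈σy → begin
          x          ≈⟨ σσ≈id x ⟨
          σ (σ x)    ≈⟨ σ.⟦⟧-cong σx≈σy ⟩
          σ (σ y)    ≈⟨ σσ≈id y ⟩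
          y          ∎
      }
    ; surjective = λ y → σ y , λ z≈σy → trans (σ.⟦⟧-cong z≈σy) (σσ≈id y)
    }
    where module σ = IsGroupHomomorphism σ-homo

  conjugate : Carrier → Carrier → Carrier
  conjugate s x = (s ∙ x) ∙ s ⁻¹

  conjugate-isGroupHomomorphism : ∀ s → IsGroupHomomorphism (conjugate s)
  conjugate-isGroupHomomorphism s =
    ∙-homo⇒isGroupHomomorphism G G (∙-congʳ ∘ ∙-congˡ) conjugate-homo
    where
    conjugate-homo : ∀ x y → conjugate s (x ∙ y) ≈ conjugate s x ∙ conjugate s y
    conjugate-homo x y = begin
      (s ∙ (x ∙ y)) ∙ s ⁻¹                   ≈⟨ ∙-congʳ (assoc s x y) ⟨
      ((s ∙ x) ∙ y) ∙ s ⁻¹                   ≈⟨ assoc (s ∙ x) y (s ⁻¹) ⟩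
      (s ∙ x) ∙ (y ∙ s ⁻¹)                   ≈⟨ cancelᶜ (inverseˡ s) (s ∙ x) (y ∙ s ⁻¹) ⟨
      ((s ∙ x) ∙ s ⁻¹) ∙ (s ∙ (y ∙ s ⁻¹))    ≈⟨ ∙-congˡ (assoc s y (s ⁻¹)) ⟨
      ((s ∙ x) ∙ s ⁻¹) ∙ ((s ∙ y) ∙ s ⁻¹)    ∎

  conjugate-∙ : ∀ s t x → conjugate s (conjugate t x) ≈ conjugate (s ∙ t) x
  conjugate-∙ s t x = begin
    (s ∙ ((t ∙ x) ∙ t ⁻¹)) ∙ s ⁻¹   ≈⟨ ∙-congʳ (assoc s (t ∙ x) (t ⁻¹)) ⟨
    ((s ∙ (t ∙ x)) ∙ t ⁻¹) ∙ s ⁻¹   ≈⟨ assoc (s ∙ (t ∙ x)) (t ⁻¹) (s ⁻¹) ⟩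
    (s ∙ (t ∙ x)) ∙ (t ⁻¹ ∙ s ⁻¹)   ≈⟨ ∙-cong (assoc s t x) (⁻¹-anti-homo-∙ s t) ⟨
    ((s ∙ t) ∙ x) ∙ (s ∙ t) ⁻¹      ∎

  conjugate-ε : ∀ x → conjugate ε x ≈ x
  conjugate-ε x = trans (∙-cong (identityˡ x) ε⁻¹≈ε) (identityʳ x)

  conjugate-involutive : ∀ {s} → s ∙ s ≈ ε → ∀ x → conjugate s (conjugate s x) ≈ x
  conjugate-involutive {s} s∙s≈ε x = begin
    conjugate s (conjugate s x)  ≈⟨ conjugate-∙ s s x ⟩
    conjugate (s ∙ s) x          ≈⟨ ∙-cong (∙-congʳ s∙s≈ε) (⁻¹-cong s∙s≈ε) ⟩
    conjugate ε x                ≈⟨ conjugate-ε x ⟩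
    x                            ∎

  Gen-trivial-or-inhabited : ∀ {S : Carrier → Set p} {x} → Gen G S x → x ≈ ε ⊎ Σ Carrier S
  Gen-trivial-or-inhabited (gen-base {x} x∈S) = inj₂ (x , x∈S)
  Gen-trivial-or-inhabited gen-ε = inj₁ refl
  Gen-trivial-or-inhabited (gen-inv g) with Gen-trivial-or-inhabited g
  ... | inj₁ x≈ε = inj₁ (trans (⁻¹-cong x≈ε) ε⁻¹≈ε)
  ... | inj₂ w   = inj₂ w
  Gen-trivial-or-inhabited (gen-mul g h) with Gen-trivial-or-inhabited g | Gen-trivial-or-inhabited h
  ... | inj₁ x≈ε | inj₁ y≈ε = inj₁ (trans (∙-cong x≈ε y≈ε) (identityˡ ε))
  ... | inj₁ _   | inj₂ w   = inj₂ w
  ... | inj₂ w   | _        = inj₂ w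
  Gen-trivial-or-inhabited (gen-resp x≈y g) with Gen-trivial-or-inhabited g
  ... | inj₁ x≈ε = inj₁ (trans (sym x≈y) x≈ε)
  ... | inj₂ w   = inj₂ w

Inverted : (G : Group c ℓ) → (Group.Carrier G → Group.Carrier G) → Group.Carrier G → Set ℓ
Inverted G σ g = σ g ≈ g ⁻¹
  where open Group G

module SemidirectC2Isomorphism (G : Group c ℓ) (G' : Group c' ℓ')
  {σ : Group.Carrier G → Group.Carrier G}
  (σ-homo : GroupMorphisms.IsGroupHomomorphism (Group.rawGroup G) (Group.rawGroup G) σ)
  (σ-involutive : ∀ g → Group._≈_ G (σ (σ g)) g)
  {φ : Group.Carrier G × Bool → Group.Carrier G'}
  (φ-iso : GroupMorphisms.IsGroupIsomorphism (SemidirectC2 G σ) (Group.rawGroup G') φ)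
  where
  private
    module G = Group G
    module σ = GroupMorphisms.IsGroupHomomorphism σ-homo
    module φ = GroupMorphisms.IsGroupIsomorphism φ-iso
  open Group G'
  open GroupProperties G using (⁻¹-involutive; ε⁻¹≈ε; inverseʳ-unique)
  open ≈-Reasoning setoid

  Inverted-σ : ∀ {g} → Inverted G σ g → Inverted G σ (σ g)
  Inverted-σ {g} σg≈g⁻¹ =
    G.trans (σ-involutive g) (G.trans (G.sym (⁻¹-involutive g)) (G.⁻¹-cong (G.sym σg≈g⁻¹)))

  Inverted-ε : Inverted G σ G.ε
  Inverted-ε = G.trans σ.ε-homo (G.sym ε⁻¹≈ε)

  Gen-Inverted-act : ∀ b {g} → Gen G (Inverted G σ) g → Gen G (Inverted G σ) (act G σ b g)
  Gen-Inverted-act false g∈ = g∈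
  Gen-Inverted-act true  g∈ = Gen-image G G σ-homo (gen-base ∘ Inverted-σ) g∈

  φ-false≉φ-true : ∀ {g h} → ¬ φ (g , false) ≈ φ (h , true)
  φ-false≉φ-true p with φ.injective p
  ... | _ , ()

  φ-true-square : ∀ a → φ (a , true) ∙ φ (a , true) ≈ φ (a G.∙ σ a , false)
  φ-true-square a = sym (φ.∙-homo (a , true) (a , true))

  Inverted⇒φ-true-involution : ∀ {a} → Inverted G σ a → Involution G' (φ (a , true))
  Inverted⇒φ-true-involution {a} σa≈a⁻¹ =
    square≈ε , λ φa≈ε → φ-false≉φ-true (trans φ.ε-homo (sym φa≈ε))
    where
    square≈ε : φ (a , true) ∙ φ (a , true) ≈ ε
    square≈ε = begin
      φ (a , true) ∙ φ (a , true)  ≈⟨ φ-true-square a ⟩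
      φ (a G.∙ σ a , false)        ≈⟨ φ.⟦⟧-cong (G.trans (G.∙-congˡ σa≈a⁻¹) (G.inverseʳ a) , ≡-refl) ⟩
      φ (G.ε , false)              ≈⟨ φ.ε-homo ⟩
      ε                            ∎

  φ-true-square≈ε⇒Inverted : ∀ {a} → φ (a , true) ∙ φ (a , true) ≈ ε → Inverted G σ a
  φ-true-square≈ε⇒Inverted {a} square≈ε =
    inverseʳ-unique a (σ a) (proj₁ (φ.injective (begin
      φ (a G.∙ σ a , false)        ≈⟨ φ-true-square a ⟨
      φ (a , true) ∙ φ (a , true)  ≈⟨ square≈ε ⟩
      ε                            ≈⟨ φ.ε-homo ⟨
      φ (G.ε , false)              ∎)))

  φ-∙-φ-ε-true : ∀ g b → φ (g , b) ∙ φ (G.ε , true) ≈ φ (g , not b)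
  φ-∙-φ-ε-true g false = trans (sym (φ.∙-homo (g , false) (G.ε , true)))
                               (φ.⟦⟧-cong (G.identityʳ g , ≡-refl))
  φ-∙-φ-ε-true g true  = trans (sym (φ.∙-homo (g , true) (G.ε , true)))
                               (φ.⟦⟧-cong (G.trans (G.∙-congˡ σ.ε-homo) (G.identityʳ g) , ≡-refl))

  InImage⟨Inverted⟩ : Carrier → Set _
  InImage⟨Inverted⟩ y = Σ G.Carrier λ a → Gen G (Inverted G σ) a × Σ Bool λ b → φ (a , b) ≈ y

  Gen⇒InImage⟨Inverted⟩ : ∀ {S : Carrier → Set p} → (∀ {y} → S y → InImage⟨Inverted⟩ y) →
                          ∀ {y} → Gen G' S y → InImage⟨Inverted⟩ y
  Gen⇒InImage⟨Inverted⟩ S⊆ (gen-base y∈S) = S⊆ y∈S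
  Gen⇒InImage⟨Inverted⟩ S⊆ gen-ε = G.ε , gen-ε , false , φ.ε-homo
  Gen⇒InImage⟨Inverted⟩ S⊆ (gen-inv g) with Gen⇒InImage⟨Inverted⟩ S⊆ g
  ... | a , a∈ , b , φab≈y =
    act G σ b (a G.⁻¹) , Gen-Inverted-act b (gen-inv a∈) , b ,
    trans (φ.⁻¹-homo (a , b)) (⁻¹-cong φab≈y)
  Gen⇒InImage⟨Inverted⟩ S⊆ (gen-mul g h)
    with Gen⇒InImage⟨Inverted⟩ S⊆ g | Gen⇒InImage⟨Inverted⟩ S⊆ h
  ... | a , a∈ , b , φab≈x | a' , a'∈ , b' , φa'b'≈y =
    a G.∙ act G σ b a' , gen-mul a∈ (Gen-Inverted-act b a'∈) , b xor b' ,
    trans (φ.∙-homo (a , b) (a' , b')) (∙-cong φab≈x φa'b'≈y)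
  Gen⇒InImage⟨Inverted⟩ S⊆ (gen-resp x≈y g) with Gen⇒InImage⟨Inverted⟩ S⊆ g
  ... | a , a∈ , b , φab≈x = a , a∈ , b , trans φab≈x x≈y

  generatedBy-restrict : ∀ {S : Carrier → Set p} → (∀ {y} → S y → InImage⟨Inverted⟩ y) →
                         GeneratedBy G' S → GeneratedBy G (Inverted G σ)
  generatedBy-restrict S⊆ S-generates g with Gen⇒InImage⟨Inverted⟩ S⊆ (S-generates (φ (g , false)))
  ... | a , a∈ , b , φab≈φg = gen-resp (proj₁ (φ.injective φab≈φg)) a∈

  φ-false-isGroupHomomorphism :
    GroupMorphisms.IsGroupHomomorphism G.rawGroup rawGroup (λ g → φ (g , false))
  φ-false-isGroupHomomorphism = ∙-homo⇒isGroupHomomorphism G G'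
    (λ x≈y → φ.⟦⟧-cong (x≈y , ≡-refl)) (λ x y → φ.∙-homo (x , false) (y , false))

  generatedBy-extend : ∀ {S : Carrier → Set p} → (∀ {a} → Inverted G σ a → S (φ (a , true))) →
                       GeneratedBy G (Inverted G σ) → GeneratedBy G' S
  generatedBy-extend {S = S} Inverted⇒S Inverted-generates y with φ.surjective y
  ... | (g , b) , φ⁻¹y = gen-resp (φ⁻¹y (G.refl , ≡-refl)) (Gen-φ b)
    where
    φ-ε-true∈ : Gen G' S (φ (G.ε , true))
    φ-ε-true∈ = gen-base (Inverted⇒S Inverted-ε)

    Gen-φ-false : ∀ {a} → Gen G (Inverted G σ) a → Gen G' S (φ (a , false))
    Gen-φ-false = Gen-image G G' φ-false-isGroupHomomorphism λ {a} a∈ →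
      gen-resp (φ-∙-φ-ε-true a true) (gen-mul (gen-base (Inverted⇒S a∈)) φ-ε-true∈)

    Gen-φ : ∀ b → Gen G' S (φ (g , b))
    Gen-φ false = Gen-φ-false (Inverted-generates g)
    Gen-φ true  = gen-resp (φ-∙-φ-ε-true g false)
                           (gen-mul (Gen-φ-false (Inverted-generates g)) φ-ε-true∈)

module ConjugationByInvolution (G : Group c ℓ) (G' : Group c' ℓ')
  {ι : Group.Carrier G → Group.Carrier G'}
  (ι-mono : GroupMorphisms.IsGroupMonomorphism (Group.rawGroup G) (Group.rawGroup G') ι)
  (normal : IsNormalImage G G' ι) (index2 : IsIndex2Image G G' ι)
  {s : Group.Carrier G'} (s∙s≈ε : Group._≈_ G' (Group._∙_ G' s s) (Group.ε G'))
  (s∉ : ¬ InImage G G' ι s)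
  where
  private
    module G = Group G
    module ι = GroupMorphisms.IsGroupMonomorphism ι-mono
  open Group G'
  open GroupProperties G' using (ε⁻¹≈ε; inverseʳ-unique; ⁻¹-anti-homo-∙; ∙-cancelʳ)
  open MonoidProperties monoid using (cancelˡ; cancelʳ; uv∙wx≈u[vw∙x])
  open ≈-Reasoning setoid

  σ : G.Carrier → G.Carrier
  σ g = proj₁ (normal s (ι g) (g , refl))

  ι-σ : ∀ g → ι (σ g) ≈ conjugate G' s (ι g)
  ι-σ g = proj₂ (normal s (ι g) (g , refl))

  σ-isGroupHomomorphism : GroupMorphisms.IsGroupHomomorphism G.rawGroup G.rawGroup σ
  σ-isGroupHomomorphism =
    restriction-isGroupHomomorphism G G' ι-mono (conjugate-isGroupHomomorphism G' s) ι-σ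

  σ-involutive : ∀ g → σ (σ g) G.≈ g
  σ-involutive g = ι.injective (begin
    ι (σ (σ g))                          ≈⟨ ι-σ (σ g) ⟩
    conjugate G' s (ι (σ g))             ≈⟨ ∙-congʳ (∙-congˡ (ι-σ g)) ⟩
    conjugate G' s (conjugate G' s (ι g)) ≈⟨ conjugate-involutive G' s∙s≈ε (ι g) ⟩
    ι g                                  ∎)

  s∙ι : ∀ g → s ∙ ι g ≈ ι (σ g) ∙ s
  s∙ι g = trans (sym (cancelʳ (inverseˡ s) (s ∙ ι g))) (∙-congʳ (sym (ι-σ g)))

  s⁻¹≈s : s ⁻¹ ≈ s
  s⁻¹≈s = sym (inverseʳ-unique s s s∙s≈ε)

  s^_ : Bool → Carrier
  s^ false = ε
  s^ true  = s

  s^-∙-ι : ∀ b g → s^ b ∙ ι g ≈ ι (act G σ b g) ∙ s^ b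
  s^-∙-ι false g = trans (identityˡ (ι g)) (sym (identityʳ (ι g)))
  s^-∙-ι true  g = s∙ι g

  s^-xor : ∀ a b → s^ a ∙ s^ b ≈ s^ (a xor b)
  s^-xor false b     = identityˡ (s^ b)
  s^-xor true  false = identityʳ s
  s^-xor true  true  = s∙s≈ε

  s^-⁻¹ : ∀ b → s^ b ⁻¹ ≈ s^ b
  s^-⁻¹ false = ε⁻¹≈ε
  s^-⁻¹ true  = s⁻¹≈s

  φ : G.Carrier × Bool → Carrier
  φ (g , b) = ι g ∙ s^ b

  open GroupMorphisms (SemidirectC2 G σ) rawGroup using (IsGroupIsomorphism)
  private
    module SD = RawGroup (SemidirectC2 G σ)

  φ-cong : ∀ {x y} → x SD.≈ y → φ x ≈ φ y
  φ-cong (g≈h , ≡-refl) = ∙-congʳ (ι.⟦⟧-cong g≈h)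

  φ-homo : ∀ x y → φ (x SD.∙ y) ≈ φ x ∙ φ y
  φ-homo (g , a) (h , b) = begin
    ι (g G.∙ act G σ a h) ∙ s^ (a xor b)     ≈⟨ ∙-cong (ι.∙-homo g (act G σ a h)) (sym (s^-xor a b)) ⟩
    (ι g ∙ ι (act G σ a h)) ∙ (s^ a ∙ s^ b)  ≈⟨ uv∙wx≈u[vw∙x] (ι g) (ι (act G σ a h)) (s^ a) (s^ b) ⟩
    ι g ∙ ((ι (act G σ a h) ∙ s^ a) ∙ s^ b)  ≈⟨ ∙-congˡ (∙-congʳ (s^-∙-ι a h)) ⟨
    ι g ∙ ((s^ a ∙ ι h) ∙ s^ b)              ≈⟨ uv∙wx≈u[vw∙x] (ι g) (s^ a) (ι h) (s^ b) ⟨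
    (ι g ∙ s^ a) ∙ (ι h ∙ s^ b)              ∎

  φ-⁻¹ : ∀ x → φ (x SD.⁻¹) ≈ φ x ⁻¹
  φ-⁻¹ (g , b) = begin
    ι (act G σ b (g G.⁻¹)) ∙ s^ b  ≈⟨ s^-∙-ι b (g G.⁻¹) ⟨
    s^ b ∙ ι (g G.⁻¹)              ≈⟨ ∙-cong (sym (s^-⁻¹ b)) (ι.⁻¹-homo g) ⟩
    s^ b ⁻¹ ∙ ι g ⁻¹               ≈⟨ ⁻¹-anti-homo-∙ (ι g) (s^ b) ⟨
    (ι g ∙ s^ b) ⁻¹                ∎

  ι∙ε≉ι∙s : ∀ {g h} → ¬ ι g ∙ ε ≈ ι h ∙ s
  ι∙ε≉ι∙s {g} {h} p = s∉ (h G.⁻¹ G.∙ g , (begin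
    ι (h G.⁻¹ G.∙ g)      ≈⟨ ι.∙-homo (h G.⁻¹) g ⟩
    ι (h G.⁻¹) ∙ ι g      ≈⟨ ∙-cong (ι.⁻¹-homo h) (sym (identityʳ (ι g))) ⟩
    ι h ⁻¹ ∙ (ι g ∙ ε)    ≈⟨ ∙-congˡ p ⟩
    ι h ⁻¹ ∙ (ι h ∙ s)    ≈⟨ cancelˡ (inverseˡ (ι h)) s ⟩
    s                     ∎))

  φ-injective : ∀ {x y} → φ x ≈ φ y → x SD.≈ y
  φ-injective {g , false} {h , false} p = ι.injective (∙-cancelʳ ε (ι g) (ι h) p) , ≡-refl
  φ-injective {g , true}  {h , true}  p = ι.injective (∙-cancelʳ s (ι g) (ι h) p) , ≡-refl
  φ-injective {g , false} {h , true}  p = ⊥-elim (ι∙ε≉ι∙s p)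
  φ-injective {g , true}  {h , false} p = ⊥-elim (ι∙ε≉ι∙s (sym p))

  φ-surjective : ∀ y → ∃ λ x → ∀ {z} → z SD.≈ x → φ z ≈ y
  φ-surjective y with index2-coset G G' ι.isGroupHomomorphism index2 s∉ y
  ... | inj₁ (a , ιa≈y) = (a , false) , λ z≈x → trans (φ-cong z≈x) (trans (identityʳ (ι a)) ιa≈y)
  ... | inj₂ (a , ιa≈s⁻¹y) = (σ a , true) , λ z≈x → trans (φ-cong z≈x) (begin
    ι (σ a) ∙ s      ≈⟨ s∙ι a ⟨
    s ∙ ι a          ≈⟨ ∙-congˡ ιa≈s⁻¹y ⟩
    s ∙ (s ⁻¹ ∙ y)   ≈⟨ cancelˡ (inverseʳ s) y ⟩
    y                ∎)

  φ-isGroupIsomorphism : IsGroupIsomorphism φ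
  φ-isGroupIsomorphism = record
    { isGroupMonomorphism = record
      { isGroupHomomorphism = record
        { isMonoidHomomorphism = record
          { isMagmaHomomorphism = record
            { isRelHomomorphism = record { cong = φ-cong }
            ; homo = φ-homo
            }
          ; ε-homo = trans (identityʳ (ι G.ε)) ι.ε-homo
          }
        ; ⁻¹-homo = φ-⁻¹
        }
      ; injective = φ-injective
      }
    ; surjective = φ-surjective
    }

  open SemidirectC2Isomorphism G G' σ-isGroupHomomorphism σ-involutive φ-isGroupIsomorphism public
    using (InImage⟨Inverted⟩; generatedBy-restrict)
  open SemidirectC2Isomorphism G G' σ-isGroupHomomorphism σ-involutive φ-isGroupIsomorphism
    using (φ-true-square≈ε⇒Inverted)

  outsideInvolution⇒InImage⟨Inverted⟩ :
    ∀ {y} → Involution G' y × ¬ InImage G G' ι y → InImage⟨Inverted⟩ y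
  outsideInvolution⇒InImage⟨Inverted⟩ {y} ((y∙y≈ε , _) , y∉) with φ-surjective y
  ... | (a , false) , φ⁻¹y = ⊥-elim (y∉ (a , trans (sym (identityʳ (ι a))) (φ⁻¹y (G.refl , ≡-refl))))
  ... | (a , true)  , φ⁻¹y = a , gen-base (φ-true-square≈ε⇒Inverted square≈ε) , true , φa≈y
    where
    φa≈y : φ (a , true) ≈ y
    φa≈y = φ⁻¹y (G.refl , ≡-refl)

    square≈ε : φ (a , true) ∙ φ (a , true) ≈ ε
    square≈ε = trans (∙-cong φa≈y φa≈y) y∙y≈ε

SemidirectC2Decomposition : (G : Group c ℓ) (G' : Group c' ℓ')
  (ι : Group.Carrier G → Group.Carrier G') → Set _
SemidirectC2Decomposition G G' ι =
  Σ (Group.Carrier G → Group.Carrier G) λ σ →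
    GroupMorphisms.IsGroupIsomorphism (Group.rawGroup G) (Group.rawGroup G) σ ×
    (∀ g → Group._≈_ G (σ (σ g)) g) ×
    GeneratedBy G (Inverted G σ) ×
    Σ (Group.Carrier G × Bool → Group.Carrier G') λ φ →
      GroupMorphisms.IsGroupIsomorphism (SemidirectC2 G σ) (Group.rawGroup G') φ ×
      (∀ h → ∃ λ g → Group._≈_ G' (φ (h , false)) (ι g)) ×
      (∀ g → ∃ λ h → Group._≈_ G' (φ (h , false)) (ι g))

module _ (G : Group c ℓ) (G' : Group c' ℓ') {ι : Group.Carrier G → Group.Carrier G'} where
  private
    module G = Group G
  open Group G'

  GIExtension⇒SemidirectC2Decomposition :
    GroupMorphisms.IsGroupMonomorphism G.rawGroup rawGroup ι →
    IsNormalImage G G' ι → IsIndex2Image G G' ι →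
    IsGIExtension G G' ι → SemidirectC2Decomposition G G' ι
  GIExtension⇒SemidirectC2Decomposition ι-mono normal index2@(t , t∉ , _) gi
    with Gen-trivial-or-inhabited G' (gi t)
  ... | inj₁ t≈ε = ⊥-elim (t∉ (G.ε , trans ι.ε-homo (sym t≈ε)))
    where module ι = GroupMorphisms.IsGroupMonomorphism ι-mono
  ... | inj₂ (s , (s∙s≈ε , _) , s∉) =
    σ , involutive-isGroupIsomorphism G σ-isGroupHomomorphism σ-involutive , σ-involutive ,
    generatedBy-restrict outsideInvolution⇒InImage⟨Inverted⟩ gi ,
    φ , φ-isGroupIsomorphism ,
    (λ h → h , identityʳ (ι h)) , (λ g → g , identityʳ (ι g))
    where open ConjugationByInvolution G G' ι-mono normal index2 s∙s≈ε s∉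

  SemidirectC2Decomposition⇒GIExtension : SemidirectC2Decomposition G G' ι → IsGIExtension G G' ι
  SemidirectC2Decomposition⇒GIExtension
    (σ , σ-iso , σ-involutive , Inverted-generates , φ , φ-iso , _ , ι⊆φ-false) =
    generatedBy-extend (λ a∈ → Inverted⇒φ-true-involution a∈ , φ-true∉) Inverted-generates
    where
    open SemidirectC2Isomorphism G G'
      (GroupMorphisms.IsGroupIsomorphism.isGroupHomomorphism σ-iso) σ-involutive φ-iso
    φ-true∉ : ∀ {a} → ¬ InImage G G' ι (φ (a , true))
    φ-true∉ (g , ιg≈φa) = φ-false≉φ-true (trans (proj₂ (ι⊆φ-false g)) ιg≈φa)

mainTheorem1 : ∀ {c ℓ c' ℓ' : Level} (G : Group c ℓ) (G' : Group c' ℓ')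
    (ι : Group.Carrier G → Group.Carrier G') →
    GroupMorphisms.IsGroupMonomorphism (Group.rawGroup G) (Group.rawGroup G') ι →
    IsNormalImage G G' ι →
    IsIndex2Image G G' ι →
    IsGIExtension G G' ι ⇔
      (Σ (Group.Carrier G → Group.Carrier G) λ σ →
        GroupMorphisms.IsGroupIsomorphism (Group.rawGroup G) (Group.rawGroup G) σ ×
        (∀ g → Group._≈_ G (σ (σ g)) g) ×
        GeneratedBy G (λ g → Group._≈_ G (σ g) (Group._⁻¹ G g)) ×
        Σ (Group.Carrier G × Bool → Group.Carrier G') λ φ →
          GroupMorphisms.IsGroupIsomorphism (SemidirectC2 G σ) (Group.rawGroup G') φ ×
          (∀ h → ∃ λ g → Group._≈_ G' (φ (h , false)) (ι g)) ×
          (∀ g → ∃ λ h → Group._≈_ G' (φ (h , false)) (ι g)))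
mainTheorem1 G G' ι ι-mono normal index2 =
  mk⇔ (GIExtension⇒SemidirectC2Decomposition G G' ι-mono normal index2)
      (SemidirectC2Decomposition⇒GIExtension G G')
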